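{- $\mathsf{Seq}$ is $\Sigma$-complete: for every $\Sigma$-sentence $\phi$ of the language $\{e,\vdash,\circ\}$, if $\mathfrak{S}\models\phi$ then $\mathsf{Seq}\vdash\phi$.
   Context: Language $\{e,\ \vdash,\ \circ\}$: $e$ constant, $\vdash$ and $\circ$ binary function symbols ($x\vdash y$ is a term, not provability). $\mathsf{Seq}$ has axioms: $\mathsf{Seq}_1$: $\forall x y\, [x\vdash y\neq e]$; $\mathsf{Seq}_2$: $\forall x_1x_2y_1y_2\,[x_1\vdash x_2=y_1\vdash y_2\rightarrow (x_1=y_1\wedge x_2=y_2)]$; $\mathsf{Seq}_3$: $\forall x\,[x\circ e=x]$; $\mathsf{Seq}_4$: $\forall xyz\,[x\circ(y\vdash z)=(x\circ y)\vdash z]$; $\mathsf{Seq}_5$: $\forall x\,[x=e\vee\exists yz\,[x=y\vdash z]]$. Sequences: $()$ is a sequence, and if $s_1,\dots,s_n$ ($n>0$) are sequences then $(s_1,\dots,s_n)$ is a sequence. The standard model $\mathfrak{S}$ has universe all sequences, $e^{\mathfrak S}=()$, $(s_1,\dots,s_n)\vdash^{\mathfrak S}t=(s_1,\dots,s_n,t)$, and $\circ^{\mathfrak S}$ is concatenation. $t_1\sqsubseteq t_2$ abbreviates $\exists y[t_1\circ y=t_2]$ and $\forall x\sqsubseteq t[\phi]$ abbreviates $\forall x[x\sqsubseteq t\rightarrow\phi]$. $\Sigma$-formulas: atomic formulas and their negations, and $s\sqsubseteq t$ and $\neg s\sqsubseteq t$ for terms $s,t$, are $\Sigma$; $\Sigma$-formulas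 are closed under $\wedge$, $\vee$, $\exists x$, and $\forall x\sqsubseteq t[\phi]$ where $t$ does not contain $x$. -}

module Defs where

open import Data.Nat using (ℕ; zero; suc)
open import Data.Fin using (Fin; zero; suc)
open import Data.List using (List; []; _∷_; _++_; [_]; map)
open import Data.List.Membership.Propositional using (_∈_)
open import Data.Product using (Σ; _×_)
open import Data.Sum using (_⊎_)
open import Data.Empty using (⊥)
open import Relation.Binary.PropositionalEquality using (_≡_)

-- Syntax of first-order logic with equality in the language {e, ⊢, ∘}
-- (de Bruijn indices: Term n / Formula n have n free variables)

infixl 7 _∘_
infixl 6 _⊢_
infix  4 _≐_
infixr 3 _∧_
infixr 2 _∨_
infixr 1 _⇒_

data Term (n : ℕ) : Set where
  v   : Fin n → Term n
  e   : Term n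
  _⊢_ : Term n → Term n → Term n
  _∘_ : Term n → Term n → Term n

data Formula (n : ℕ) : Set where
  ⊥'  : Formula n
  _≐_ : Term n → Term n → Formula n
  _⇒_ : Formula n → Formula n → Formula n
  _∧_ : Formula n → Formula n → Formula n
  _∨_ : Formula n → Formula n → Formula n
  ∀'  : Formula (suc n) → Formula n
  ∃'  : Formula (suc n) → Formula n

¬' : ∀ {n} → Formula n → Formula n
¬' φ = φ ⇒ ⊥'

liftR : ∀ {m n} → (Fin m → Fin n) → Fin (suc m) → Fin (suc n)
liftR ρ zero    = zero
liftR ρ (suc i) = suc (ρ i)

renT : ∀ {m n} → (Fin m → Fin n) → Term m → Term n
renT ρ (v i)   = v (ρ i)
renT ρ e       = e
renT ρ (s ⊢ t) = renT ρ s ⊢ renT ρ t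
renT ρ (s ∘ t) = renT ρ s ∘ renT ρ t

renF : ∀ {m n} → (Fin m → Fin n) → Formula m → Formula n
renF ρ ⊥'      = ⊥'
renF ρ (s ≐ t) = renT ρ s ≐ renT ρ t
renF ρ (φ ⇒ ψ) = renF ρ φ ⇒ renF ρ ψ
renF ρ (φ ∧ ψ) = renF ρ φ ∧ renF ρ ψ
renF ρ (φ ∨ ψ) = renF ρ φ ∨ renF ρ ψ
renF ρ (∀' φ)  = ∀' (renF (liftR ρ) φ)
renF ρ (∃' φ)  = ∃' (renF (liftR ρ) φ)

wkT : ∀ {n} → Term n → Term (suc n)
wkT = renT suc

wkF : ∀ {n} → Formula n → Formula (suc n)
wkF = renF suc

liftS : ∀ {m n} → (Fin m → Term n) → Fin (suc m) → Term (suc n)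
liftS σ zero    = v zero
liftS σ (suc i) = wkT (σ i)

subT : ∀ {m n} → (Fin m → Term n) → Term m → Term n
subT σ (v i)   = σ i
subT σ e       = e
subT σ (s ⊢ t) = subT σ s ⊢ subT σ t
subT σ (s ∘ t) = subT σ s ∘ subT σ t

subF : ∀ {m n} → (Fin m → Term n) → Formula m → Formula n
subF σ ⊥'      = ⊥'
subF σ (s ≐ t) = subT σ s ≐ subT σ t
subF σ (φ ⇒ ψ) = subF σ φ ⇒ subF σ ψ
subF σ (φ ∧ ψ) = subF σ φ ∧ subF σ ψ
subF σ (φ ∨ ψ) = subF σ φ ∨ subF σ ψ
subF σ (∀' φ)  = ∀' (subF (liftS σ) φ)
subF σ (∃' φ)  = ∃' (subF (liftS σ) φ)

_⟨_⟩ : ∀ {n} → Formula (suc n) → Term n → Formula n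
φ ⟨ t ⟩ = subF (λ { zero → t ; (suc i) → v i }) φ

-- Abbreviations: s ⊑ t  :=  ∃y [s ∘ y = t],
-- bounded ∀x ⊑ t [φ] := ∀x [x ⊑ t → φ]  (t cannot mention x: de Bruijn)

_⊑_ : ∀ {n} → Term n → Term n → Formula n
s ⊑ t = ∃' (wkT s ∘ v zero ≐ wkT t)

∀⊑ : ∀ {n} → Term n → Formula (suc n) → Formula n
∀⊑ t φ = ∀' ((v zero ⊑ wkT t) ⇒ φ)

data IsΣ {n : ℕ} : Formula n → Set where
  atom    : ∀ s t → IsΣ (s ≐ t)
  negatom : ∀ s t → IsΣ (¬' (s ≐ t))
  sub     : ∀ s t → IsΣ (s ⊑ t)
  negsub  : ∀ s t → IsΣ (¬' (s ⊑ t))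
  and     : ∀ {φ ψ} → IsΣ φ → IsΣ ψ → IsΣ (φ ∧ ψ)
  or      : ∀ {φ ψ} → IsΣ φ → IsΣ ψ → IsΣ (φ ∨ ψ)
  ex      : ∀ {φ} → IsΣ φ → IsΣ (∃' φ)
  ball    : ∀ t {φ} → IsΣ φ → IsΣ (∀⊑ t φ)

infix 0 _⊩_

data _⊩_ {n : ℕ} (Γ : List (Formula n)) : Formula n → Set where
  ax   : ∀ {φ} → φ ∈ Γ → Γ ⊩ φ
  ⇒I   : ∀ {φ ψ} → (φ ∷ Γ) ⊩ ψ → Γ ⊩ φ ⇒ ψ
  ⇒E   : ∀ {φ ψ} → Γ ⊩ φ ⇒ ψ → Γ ⊩ φ → Γ ⊩ ψ
  ∧I   : ∀ {φ ψ} → Γ ⊩ φ → Γ ⊩ ψ → Γ ⊩ φ ∧ ψ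
  ∧E₁  : ∀ {φ ψ} → Γ ⊩ φ ∧ ψ → Γ ⊩ φ
  ∧E₂  : ∀ {φ ψ} → Γ ⊩ φ ∧ ψ → Γ ⊩ ψ
  ∨I₁  : ∀ {φ ψ} → Γ ⊩ φ → Γ ⊩ φ ∨ ψ
  ∨I₂  : ∀ {φ ψ} → Γ ⊩ ψ → Γ ⊩ φ ∨ ψ
  ∨E   : ∀ {φ ψ χ} → Γ ⊩ φ ∨ ψ → (φ ∷ Γ) ⊩ χ → (ψ ∷ Γ) ⊩ χ → Γ ⊩ χ
  raa  : ∀ {φ} → (¬' φ ∷ Γ) ⊩ ⊥' → Γ ⊩ φ
  ∀I   : ∀ {φ} → map wkF Γ ⊩ φ → Γ ⊩ ∀' φ
  ∀E   : ∀ {φ} → Γ ⊩ ∀' φ → (t : Term n) → Γ ⊩ φ ⟨ t ⟩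
  ∃I   : ∀ {φ} (t : Term n) → Γ ⊩ φ ⟨ t ⟩ → Γ ⊩ ∃' φ
  ∃E   : ∀ {φ ψ} → Γ ⊩ ∃' φ → (φ ∷ map wkF Γ) ⊩ wkF ψ → Γ ⊩ ψ
  ≐refl : ∀ t → Γ ⊩ t ≐ t
  ≐subst : ∀ {s t} (φ : Formula (suc n)) → Γ ⊩ s ≐ t → Γ ⊩ φ ⟨ s ⟩ → Γ ⊩ φ ⟨ t ⟩

Seq₁ Seq₂ Seq₃ Seq₄ Seq₅ : Formula 0
Seq₁ = ∀' (∀' (¬' (v (suc zero) ⊢ v zero ≐ e)))
-- ∀x1 x2 y1 y2 [x1 ⊢ x2 = y1 ⊢ y2 → x1 = y1 ∧ x2 = y2]
Seq₂ = ∀' (∀' (∀' (∀' (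
         (x₁ ⊢ x₂ ≐ y₁ ⊢ y₂) ⇒ ((x₁ ≐ y₁) ∧ (x₂ ≐ y₂))))))
  where
  x₁ x₂ y₁ y₂ : Term 4
  x₁ = v (suc (suc (suc zero)))
  x₂ = v (suc (suc zero))
  y₁ = v (suc zero)
  y₂ = v zero
Seq₃ = ∀' (v zero ∘ e ≐ v zero)
-- ∀x y z [x ∘ (y ⊢ z) = (x ∘ y) ⊢ z]
Seq₄ = ∀' (∀' (∀' (x ∘ (y ⊢ z) ≐ (x ∘ y) ⊢ z)))
  where
  x y z : Term 3
  x = v (suc (suc zero))
  y = v (suc zero)
  z = v zero
-- ∀x [x = e ∨ ∃y z [x = y ⊢ z]]
Seq₅ = ∀' ((v zero ≐ e) ∨ ∃' (∃' (v (suc (suc zero)) ≐ v (suc zero) ⊢ v zero)))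

SeqAxioms : List (Formula 0)
SeqAxioms = Seq₁ ∷ Seq₂ ∷ Seq₃ ∷ Seq₄ ∷ Seq₅ ∷ []

SeqProves : Formula 0 → Set
SeqProves φ = SeqAxioms ⊩ φ

-- The standard model 𝔖: hereditarily finite sequences

data 𝕊 : Set where
  seq : List 𝕊 → 𝕊

eˢ : 𝕊
eˢ = seq []

_⊢ˢ_ : 𝕊 → 𝕊 → 𝕊
seq xs ⊢ˢ t = seq (xs ++ [ t ])

_∘ˢ_ : 𝕊 → 𝕊 → 𝕊
seq xs ∘ˢ seq ys = seq (xs ++ ys)

⟦_⟧t : ∀ {n} → Term n → (Fin n → 𝕊) → 𝕊
⟦ v i ⟧t ρ   = ρ i
⟦ e ⟧t ρ     = eˢ
⟦ s ⊢ t ⟧t ρ = ⟦ s ⟧t ρ ⊢ˢ ⟦ t ⟧t ρ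
⟦ s ∘ t ⟧t ρ = ⟦ s ⟧t ρ ∘ˢ ⟦ t ⟧t ρ

extend : ∀ {n} → (Fin n → 𝕊) → 𝕊 → Fin (suc n) → 𝕊
extend ρ a zero    = a
extend ρ a (suc i) = ρ i

⟦_⟧ : ∀ {n} → Formula n → (Fin n → 𝕊) → Set
⟦ ⊥' ⟧ ρ    = ⊥
⟦ s ≐ t ⟧ ρ = ⟦ s ⟧t ρ ≡ ⟦ t ⟧t ρ
⟦ φ ⇒ ψ ⟧ ρ = ⟦ φ ⟧ ρ → ⟦ ψ ⟧ ρ
⟦ φ ∧ ψ ⟧ ρ = ⟦ φ ⟧ ρ × ⟦ ψ ⟧ ρ
⟦ φ ∨ ψ ⟧ ρ = ⟦ φ ⟧ ρ ⊎ ⟦ ψ ⟧ ρ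
⟦ ∀' φ ⟧ ρ  = (a : 𝕊) → ⟦ φ ⟧ (extend ρ a)
⟦ ∃' φ ⟧ ρ  = Σ 𝕊 (λ a → ⟦ φ ⟧ (extend ρ a))

noVars : Fin 0 → 𝕊
noVars ()

_⊨𝔖 : Formula 0 → Set
φ ⊨𝔖 = ⟦ φ ⟧ noVars

-- Every sequence a has a numeral ⌜a⌝ built from e and ⊢ alone. Seq proves every true
-- equation t = ⌜a⌝ for closed t by evaluating ∘ with Seq₃ and Seq₄, and refutes every
-- false equation ⌜a⌝ = ⌜b⌝ by peeling off last entries with Seq₁ and Seq₂. By Seq₅,
-- x ∘ y = ⌜a⌝ forces x to be the numeral of a prefix of a, so a bounded quantifier
-- ∀x ⊑ ⌜a⌝ becomes a finite case distinction, and Σ-formulas true in 𝔖 are proved by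
-- induction on their structure, witnesses of ∃ being numerals.
module Submission where

open import Defs
open import Data.Nat using (ℕ; zero; suc)
open import Data.Fin using (Fin; zero; suc)
open import Data.List using (List; []; _∷_; _++_; [_]; map; reverse; _ʳ++_)
open import Data.List.Properties using (reverse-involutive; reverse-injective; unfold-reverse; ++-assoc; ++-identityʳ)
open import Data.List.Relation.Unary.All as All using (All; []; _∷_)
open import Data.List.Relation.Unary.Any using (here; there)
open import Data.List.Relation.Unary.Any.Properties using (reverse⁻)
open import Data.List.Membership.Propositional using (_∈_)
open import Data.List.Membership.Propositional.Properties using (∈-map⁺)
open import Data.List.Relation.Binary.Subset.Propositional using (_⊆_)
open import Data.List.Relation.Binary.Subset.Propositional.Properties using (map⁺; ∷⁺ʳ)
open import Data.Product using (Σ; _,_)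
open import Data.Sum using (_⊎_; inj₁; inj₂)
open import Data.Empty using (⊥-elim)
open import Relation.Binary.PropositionalEquality
  using (_≡_; refl; sym; trans; cong; cong₂; subst; subst₂; _≗_; module ≡-Reasoning)

private
  variable
    k m n : ℕ

-- The substitution of φ ⟨ t ⟩ is an anonymous pattern lambda inside Defs; reading it back
-- off an instance makes φ ⟨ t ⟩ and subF (inst t) φ definitionally equal.
inst : Term n → Fin (suc n) → Term n
inst t i = lhs ((v i ≐ e) ⟨ t ⟩)
  where
  lhs : Formula _ → Term _
  lhs (a ≐ _) = a
  lhs _       = e

subT-inst-wkT : (u t : Term n) → subT (inst u) (wkT t) ≡ t
subT-inst-wkT u (v i)   = refl
subT-inst-wkT u e       = refl
subT-inst-wkT u (s ⊢ t) = cong₂ _⊢_ (subT-inst-wkT u s) (subT-inst-wkT u t)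
subT-inst-wkT u (s ∘ t) = cong₂ _∘_ (subT-inst-wkT u s) (subT-inst-wkT u t)

subT-liftS-wkT : (σ : Fin m → Term n) (t : Term m) → subT (liftS σ) (wkT t) ≡ wkT (subT σ t)
subT-liftS-wkT σ (v i)   = refl
subT-liftS-wkT σ e       = refl
subT-liftS-wkT σ (s ⊢ t) = cong₂ _⊢_ (subT-liftS-wkT σ s) (subT-liftS-wkT σ t)
subT-liftS-wkT σ (s ∘ t) = cong₂ _∘_ (subT-liftS-wkT σ s) (subT-liftS-wkT σ t)

subT-liftS-inst-wkT² : (u t : Term n) → subT (liftS (inst u)) (wkT (wkT t)) ≡ wkT t
subT-liftS-inst-wkT² u t = trans (subT-liftS-wkT (inst u) (wkT t)) (cong wkT (subT-inst-wkT u t))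

subT-liftS²-inst-wkT³ : (u t : Term n) →
  subT (liftS (liftS (inst u))) (wkT (wkT (wkT t))) ≡ wkT (wkT t)
subT-liftS²-inst-wkT³ u t =
  trans (subT-liftS-wkT (liftS (inst u)) (wkT (wkT t))) (cong wkT (subT-liftS-inst-wkT² u t))

subT-ext : {σ τ : Fin m → Term n} → σ ≗ τ → subT σ ≗ subT τ
subT-ext h (v i)   = h i
subT-ext h e       = refl
subT-ext h (s ⊢ t) = cong₂ _⊢_ (subT-ext h s) (subT-ext h t)
subT-ext h (s ∘ t) = cong₂ _∘_ (subT-ext h s) (subT-ext h t)

liftS-ext : {σ τ : Fin m → Term n} → σ ≗ τ → liftS σ ≗ liftS τ
liftS-ext h zero    = refl
liftS-ext h (suc i) = cong wkT (h i)

subF-ext : {σ τ : Fin m → Term n} → σ ≗ τ → subF σ ≗ subF τ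
subF-ext h ⊥'      = refl
subF-ext h (s ≐ t) = cong₂ _≐_ (subT-ext h s) (subT-ext h t)
subF-ext h (φ ⇒ ψ) = cong₂ _⇒_ (subF-ext h φ) (subF-ext h ψ)
subF-ext h (φ ∧ ψ) = cong₂ _∧_ (subF-ext h φ) (subF-ext h ψ)
subF-ext h (φ ∨ ψ) = cong₂ _∨_ (subF-ext h φ) (subF-ext h ψ)
subF-ext h (∀' φ)  = cong ∀' (subF-ext (liftS-ext h) φ)
subF-ext h (∃' φ)  = cong ∃' (subF-ext (liftS-ext h) φ)

module _ {l} {τ : Fin m → Term n} {τ′ : Fin l → Term m} {τ″ : Fin l → Term n} where

  subT-comp : (∀ i → subT τ (τ′ i) ≡ τ″ i) → ∀ t → subT τ (subT τ′ t) ≡ subT τ″ t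
  subT-comp h (v i)   = h i
  subT-comp h e       = refl
  subT-comp h (s ⊢ t) = cong₂ _⊢_ (subT-comp h s) (subT-comp h t)
  subT-comp h (s ∘ t) = cong₂ _∘_ (subT-comp h s) (subT-comp h t)

  liftS-comp : (∀ i → subT τ (τ′ i) ≡ τ″ i) → ∀ i → subT (liftS τ) (liftS τ′ i) ≡ liftS τ″ i
  liftS-comp h zero    = refl
  liftS-comp h (suc i) = trans (subT-liftS-wkT τ (τ′ i)) (cong wkT (h i))

subF-comp : ∀ {l} {τ : Fin m → Term n} {τ′ : Fin l → Term m} {τ″ : Fin l → Term n} →
  (∀ i → subT τ (τ′ i) ≡ τ″ i) → ∀ φ → subF τ (subF τ′ φ) ≡ subF τ″ φ
subF-comp h ⊥'      = refl
subF-comp h (s ≐ t) = cong₂ _≐_ (subT-comp h s) (subT-comp h t)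
subF-comp h (φ ⇒ ψ) = cong₂ _⇒_ (subF-comp h φ) (subF-comp h ψ)
subF-comp h (φ ∧ ψ) = cong₂ _∧_ (subF-comp h φ) (subF-comp h ψ)
subF-comp h (φ ∨ ψ) = cong₂ _∨_ (subF-comp h φ) (subF-comp h ψ)
subF-comp h (∀' φ)  = cong ∀' (subF-comp (liftS-comp h) φ)
subF-comp h (∃' φ)  = cong ∃' (subF-comp (liftS-comp h) φ)

subT-v : (t : Term n) → subT v t ≡ t
subT-v (v i)   = refl
subT-v e       = refl
subT-v (s ⊢ t) = cong₂ _⊢_ (subT-v s) (subT-v t)
subT-v (s ∘ t) = cong₂ _∘_ (subT-v s) (subT-v t)

liftS-v : liftS {n} v ≗ v
liftS-v zero    = refl
liftS-v (suc i) = refl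

subF-v : (φ : Formula n) → subF v φ ≡ φ
subF-v ⊥'      = refl
subF-v (s ≐ t) = cong₂ _≐_ (subT-v s) (subT-v t)
subF-v (φ ⇒ ψ) = cong₂ _⇒_ (subF-v φ) (subF-v ψ)
subF-v (φ ∧ ψ) = cong₂ _∧_ (subF-v φ) (subF-v ψ)
subF-v (φ ∨ ψ) = cong₂ _∨_ (subF-v φ) (subF-v ψ)
subF-v (∀' φ)  = cong ∀' (trans (subF-ext liftS-v φ) (subF-v φ))
subF-v (∃' φ)  = cong ∃' (trans (subF-ext liftS-v φ) (subF-v φ))

subF-⊑ : (σ : Fin m → Term n) (s t : Term m) → subF σ (s ⊑ t) ≡ (subT σ s ⊑ subT σ t)
subF-⊑ σ s t = cong₂ (λ a b → ∃' (a ∘ v zero ≐ b)) (subT-liftS-wkT σ s) (subT-liftS-wkT σ t)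

weaken : {Γ Δ : List (Formula n)} {φ : Formula n} → Γ ⊆ Δ → Γ ⊩ φ → Δ ⊩ φ
weaken s (ax p)          = ax (s p)
weaken s (⇒I d)          = ⇒I (weaken (∷⁺ʳ _ s) d)
weaken s (⇒E d d′)       = ⇒E (weaken s d) (weaken s d′)
weaken s (∧I d d′)       = ∧I (weaken s d) (weaken s d′)
weaken s (∧E₁ d)         = ∧E₁ (weaken s d)
weaken s (∧E₂ d)         = ∧E₂ (weaken s d)
weaken s (∨I₁ d)         = ∨I₁ (weaken s d)
weaken s (∨I₂ d)         = ∨I₂ (weaken s d)
weaken s (∨E d d₁ d₂)    = ∨E (weaken s d) (weaken (∷⁺ʳ _ s) d₁) (weaken (∷⁺ʳ _ s) d₂)
weaken s (raa d)         = raa (weaken (∷⁺ʳ _ s) d)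
weaken s (∀I d)          = ∀I (weaken (map⁺ wkF s) d)
weaken s (∀E d t)        = ∀E (weaken s d) t
weaken s (∃I t d)        = ∃I t (weaken s d)
weaken s (∃E d d′)       = ∃E (weaken s d) (weaken (∷⁺ʳ _ (map⁺ wkF s)) d′)
weaken s (≐refl t)       = ≐refl t
weaken s (≐subst φ d d′) = ≐subst φ (weaken s d) (weaken s d′)

module _ {Γ : List (Formula m)} where

  hyp : {φ : Formula m} → (φ ∷ Γ) ⊩ φ
  hyp = ax (here refl)

  efq : {φ : Formula m} → Γ ⊩ ⊥' → Γ ⊩ φ
  efq d = raa (weaken there d)

  cut : {φ ψ : Formula m} → Γ ⊩ φ → (φ ∷ Γ) ⊩ ψ → Γ ⊩ ψ
  cut d d′ = ⇒E (⇒I d′) d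

  ≐-cast : {s s′ t t′ : Term m} → s ≡ s′ → t ≡ t′ → Γ ⊩ s ≐ t → Γ ⊩ s′ ≐ t′
  ≐-cast = subst₂ (λ a b → Γ ⊩ a ≐ b)

  ≐sym : {s t : Term m} → Γ ⊩ s ≐ t → Γ ⊩ t ≐ s
  ≐sym {s} {t} d = subst (λ z → Γ ⊩ t ≐ z) (subT-inst-wkT t s)
    (≐subst (v zero ≐ wkT s) d (subst (λ z → Γ ⊩ s ≐ z) (sym (subT-inst-wkT s s)) (≐refl s)))

  ≐trans : {s t u : Term m} → Γ ⊩ s ≐ t → Γ ⊩ t ≐ u → Γ ⊩ s ≐ u
  ≐trans {s} {t} {u} d d′ = subst (λ z → Γ ⊩ z ≐ u) (subT-inst-wkT u s)
    (≐subst (wkT s ≐ v zero) d′ (subst (λ z → Γ ⊩ z ≐ t) (sym (subT-inst-wkT t s)) d))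

  ≐cong : {s t : Term m} (c : Term (suc m)) → Γ ⊩ s ≐ t → Γ ⊩ subT (inst s) c ≐ subT (inst t) c
  ≐cong {s} {t} c d = subst (λ z → Γ ⊩ z ≐ subT (inst t) c) (subT-inst-wkT t cs)
    (≐subst (wkT cs ≐ c) d (subst (λ z → Γ ⊩ z ≐ cs) (sym (subT-inst-wkT s cs)) (≐refl cs)))
    where cs = subT (inst s) c

  ⊢-cong : {s s′ t t′ : Term m} → Γ ⊩ s ≐ s′ → Γ ⊩ t ≐ t′ → Γ ⊩ s ⊢ t ≐ s′ ⊢ t′
  ⊢-cong {s} {s′} {t} {t′} d d′ = ≐trans
    (≐-cast (cong (_⊢ t) (subT-inst-wkT t s)) (cong (_⊢ t′) (subT-inst-wkT t′ s))
      (≐cong (wkT s ⊢ v zero) d′))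
    (≐-cast (cong (s ⊢_) (subT-inst-wkT s t′)) (cong (s′ ⊢_) (subT-inst-wkT s′ t′))
      (≐cong (v zero ⊢ wkT t′) d))

  ∘-cong : {s s′ t t′ : Term m} → Γ ⊩ s ≐ s′ → Γ ⊩ t ≐ t′ → Γ ⊩ s ∘ t ≐ s′ ∘ t′
  ∘-cong {s} {s′} {t} {t′} d d′ = ≐trans
    (≐-cast (cong (_∘ t) (subT-inst-wkT t s)) (cong (_∘ t′) (subT-inst-wkT t′ s))
      (≐cong (wkT s ∘ v zero) d′))
    (≐-cast (cong (s ∘_) (subT-inst-wkT s t′)) (cong (s′ ∘_) (subT-inst-wkT s′ t′))
      (≐cong (v zero ∘ wkT t′) d))

  ⊑-resp-≐ : {x u u′ : Term m} → Γ ⊩ u ≐ u′ → Γ ⊩ x ⊑ u → Γ ⊩ x ⊑ u′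
  ⊑-resp-≐ {x} {u} {u′} d d′ =
    subst (λ z → Γ ⊩ ∃' (z ∘ v zero ≐ wkT u′)) (subT-liftS-inst-wkT² u′ x)
      (≐subst (∃' (wkT (wkT x) ∘ v zero ≐ v (suc zero))) d
        (subst (λ z → Γ ⊩ ∃' (z ∘ v zero ≐ wkT u)) (sym (subT-liftS-inst-wkT² u x)) d′))

fromClosed : Formula 0 → Formula n
fromClosed = renF (λ ())

record HasSeqAxioms (Γ : List (Formula n)) : Set where
  field
    seq₁ : fromClosed Seq₁ ∈ Γ
    seq₂ : fromClosed Seq₂ ∈ Γ
    seq₃ : fromClosed Seq₃ ∈ Γ
    seq₄ : fromClosed Seq₄ ∈ Γ
    seq₅ : fromClosed Seq₅ ∈ Γ
open HasSeqAxioms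

SeqAxioms-HasSeqAxioms : HasSeqAxioms SeqAxioms
SeqAxioms-HasSeqAxioms = record
  { seq₁ = here refl
  ; seq₂ = there (here refl)
  ; seq₃ = there (there (here refl))
  ; seq₄ = there (there (there (here refl)))
  ; seq₅ = there (there (there (there (here refl))))
  }

HasSeqAxioms-⊆ : {Γ Δ : List (Formula n)} → Γ ⊆ Δ → HasSeqAxioms Γ → HasSeqAxioms Δ
HasSeqAxioms-⊆ s A = record
  { seq₁ = s (seq₁ A) ; seq₂ = s (seq₂ A) ; seq₃ = s (seq₃ A) ; seq₄ = s (seq₄ A) ; seq₅ = s (seq₅ A) }

HasSeqAxioms-∷ : {Γ : List (Formula n)} (φ : Formula n) → HasSeqAxioms Γ → HasSeqAxioms (φ ∷ Γ)
HasSeqAxioms-∷ _ = HasSeqAxioms-⊆ there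

HasSeqAxioms-wkF : {Γ : List (Formula n)} → HasSeqAxioms Γ → HasSeqAxioms (map wkF Γ)
HasSeqAxioms-wkF A = record
  { seq₁ = ∈-map⁺ wkF (seq₁ A) ; seq₂ = ∈-map⁺ wkF (seq₂ A) ; seq₃ = ∈-map⁺ wkF (seq₃ A)
  ; seq₄ = ∈-map⁺ wkF (seq₄ A) ; seq₅ = ∈-map⁺ wkF (seq₅ A) }

-- A formula derivable from Seq at every number of free variables and in every context
-- containing the axioms; this is what survives going under binders.
Derivable : (∀ {k} → Formula k) → Set
Derivable φ = ∀ {k} {Γ : List (Formula k)} → HasSeqAxioms Γ → Γ ⊩ φ

module _ {Γ : List (Formula m)} (A : HasSeqAxioms Γ) where

  ⊢≢e : (a b : Term m) → Γ ⊩ ¬' (a ⊢ b ≐ e)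
  ⊢≢e a b = subst (λ z → Γ ⊩ ¬' (z ⊢ b ≐ e)) (subT-inst-wkT b a) (∀E (∀E (ax (seq₁ A)) a) b)

  ⊢-injective : (a b c d : Term m) → Γ ⊩ (a ⊢ b ≐ c ⊢ d) ⇒ ((a ≐ c) ∧ (b ≐ d))
  ⊢-injective a b c d =
    subst₂ (λ z w → Γ ⊩ G z w c d) (subT-inst-wkT d a) (subT-inst-wkT d b)
      (subst (λ z → Γ ⊩ G (subT (inst d) (wkT a)) (subT (inst d) (wkT b)) z d) (subT-inst-wkT d c)
        (∀E instABC d))
    where
    G : ∀ {k} → Term k → Term k → Term k → Term k → Formula k
    G x y z w = (x ⊢ y ≐ z ⊢ w) ⇒ ((x ≐ z) ∧ (y ≐ w))
    instAB : Γ ⊩ ∀' (∀' (G (wkT (wkT a)) (wkT (wkT b)) (v (suc zero)) (v zero)))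
    instAB = subst (λ z → Γ ⊩ ∀' (∀' (G z (wkT (wkT b)) (v (suc zero)) (v zero))))
               (subT-liftS²-inst-wkT³ b a) (∀E (∀E (ax (seq₂ A)) a) b)
    instABC : Γ ⊩ ∀' (G (wkT a) (wkT b) (wkT c) (v zero))
    instABC = subst₂ (λ z w → Γ ⊩ ∀' (G z w (wkT c) (v zero)))
                (subT-liftS-inst-wkT² c a) (subT-liftS-inst-wkT² c b) (∀E instAB c)

  ∘-identityʳ : (a : Term m) → Γ ⊩ a ∘ e ≐ a
  ∘-identityʳ a = ∀E (ax (seq₃ A)) a

  ∘-⊢ : (a b c : Term m) → Γ ⊩ a ∘ (b ⊢ c) ≐ (a ∘ b) ⊢ c
  ∘-⊢ a b c = subst₂ (λ z w → Γ ⊩ G z w c) (subT-inst-wkT c a) (subT-inst-wkT c b) (∀E instAB c)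
    where
    G : ∀ {k} → Term k → Term k → Term k → Formula k
    G x y z = x ∘ (y ⊢ z) ≐ (x ∘ y) ⊢ z
    instAB : Γ ⊩ ∀' (G (wkT a) (wkT b) (v zero))
    instAB = subst (λ z → Γ ⊩ ∀' (G z (wkT b) (v zero)))
               (subT-liftS-inst-wkT² b a) (∀E (∀E (ax (seq₄ A)) a) b)

e-or-⊢-elim : {Γ : List (Formula m)} {χ : Formula m} → HasSeqAxioms Γ → (y : Term m) →
  ((y ≐ e) ∷ Γ) ⊩ χ →
  ((wkT (wkT y) ≐ v (suc zero) ⊢ v zero) ∷ map wkF (map wkF Γ)) ⊩ wkF (wkF χ) →
  Γ ⊩ χ
e-or-⊢-elim {Γ = Γ} A y case-e case-⊢ =
  ∨E (∀E (ax (seq₅ A)) y) case-e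
     (∃E hyp (∃E hyp (weaken (∷⁺ʳ _ (map⁺ wkF (λ p → there (there p)))) case-⊢)))

mutual
  num : 𝕊 → Term k
  num (seq xs) = numA e xs

  -- The accumulator keeps the recursion through the nested lists structural.
  numA : Term k → List 𝕊 → Term k
  numA acc []       = acc
  numA acc (x ∷ xs) = numA (acc ⊢ num x) xs

nums : (Fin n → 𝕊) → Fin n → Term k
nums ρ i = num (ρ i)

-- The numeral of seq (reverse r), built so that ⊢ exposes its last entry.
numʳ : List 𝕊 → Term k
numʳ []      = e
numʳ (x ∷ r) = numʳ r ⊢ num x

numA-++ : (acc : Term k) (xs ys : List 𝕊) → numA acc (xs ++ ys) ≡ numA (numA acc xs) ys
numA-++ acc []       ys = refl
numA-++ acc (x ∷ xs) ys = numA-++ (acc ⊢ num x) xs ys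

numA-numʳ : (r xs : List 𝕊) → numA {k} (numʳ r) xs ≡ numʳ (xs ʳ++ r)
numA-numʳ r []       = refl
numA-numʳ r (x ∷ xs) = numA-numʳ (x ∷ r) xs

num-seq : (xs : List 𝕊) → num {k} (seq xs) ≡ numʳ (reverse xs)
num-seq = numA-numʳ []

num-seq-reverse : (r : List 𝕊) → num {k} (seq (reverse r)) ≡ numʳ r
num-seq-reverse r = trans (num-seq (reverse r)) (cong numʳ (reverse-involutive r))

mutual
  renT-num : (ρ : Fin m → Fin n) (a : 𝕊) → renT ρ (num a) ≡ num a
  renT-num ρ (seq xs) = renT-numA ρ e xs

  renT-numA : (ρ : Fin m → Fin n) (acc : Term m) (xs : List 𝕊) →
    renT ρ (numA acc xs) ≡ numA (renT ρ acc) xs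
  renT-numA ρ acc []       = refl
  renT-numA ρ acc (x ∷ xs) =
    trans (renT-numA ρ (acc ⊢ num x) xs) (cong (λ z → numA (renT ρ acc ⊢ z) xs) (renT-num ρ x))

num-⊢ˢ : (a c : 𝕊) → num {k} (a ⊢ˢ c) ≡ num a ⊢ num c
num-⊢ˢ (seq xs) c = numA-++ e xs [ c ]

wkT-num : (a : 𝕊) → wkT {n} (num a) ≡ num a
wkT-num = renT-num suc

wkT-numʳ : (r : List 𝕊) → wkT {n} (numʳ r) ≡ numʳ r
wkT-numʳ []      = refl
wkT-numʳ (x ∷ r) = cong₂ _⊢_ (wkT-numʳ r) (wkT-num x)

subT-liftS-nums-wkT : (ρ : Fin n → 𝕊) (t : Term n) →
  subT (liftS (nums {k = k} ρ)) (wkT t) ≡ subT (nums ρ) t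
subT-liftS-nums-wkT ρ (v i)   = wkT-num (ρ i)
subT-liftS-nums-wkT ρ e       = refl
subT-liftS-nums-wkT ρ (s ⊢ t) = cong₂ _⊢_ (subT-liftS-nums-wkT ρ s) (subT-liftS-nums-wkT ρ t)
subT-liftS-nums-wkT ρ (s ∘ t) = cong₂ _∘_ (subT-liftS-nums-wkT ρ s) (subT-liftS-nums-wkT ρ t)

subF-inst-num : (ρ : Fin n → 𝕊) (a : 𝕊) (φ : Formula (suc n)) →
  subF (inst (num a)) (subF (liftS (nums {k = k} ρ)) φ) ≡ subF (nums (extend ρ a)) φ
subF-inst-num ρ a = subF-comp λ where
  zero    → refl
  (suc i) → subT-inst-wkT (num a) (num (ρ i))

subF-inst-v₀ : (ρ : Fin n → 𝕊) (φ : Formula (suc n)) →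
  subF (inst (v zero)) (subF (liftS (nums {k = suc k} ρ)) φ) ≡ subF (liftS (nums ρ)) φ
subF-inst-v₀ ρ = subF-comp λ where
  zero    → refl
  (suc i) → trans (subT-inst-wkT (v zero) (num (ρ i))) (sym (wkT-num (ρ i)))

⟦wkT⟧ : (t : Term n) (ρ : Fin n → 𝕊) (a : 𝕊) → ⟦ wkT t ⟧t (extend ρ a) ≡ ⟦ t ⟧t ρ
⟦wkT⟧ (v i)   ρ a = refl
⟦wkT⟧ e       ρ a = refl
⟦wkT⟧ (s ⊢ t) ρ a = cong₂ _⊢ˢ_ (⟦wkT⟧ s ρ a) (⟦wkT⟧ t ρ a)
⟦wkT⟧ (s ∘ t) ρ a = cong₂ _∘ˢ_ (⟦wkT⟧ s ρ a) (⟦wkT⟧ t ρ a)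

-- Closed terms evaluate to numerals

module _ {Γ : List (Formula m)} (A : HasSeqAxioms Γ) where

  numA-cong : {u w : Term m} (ys : List 𝕊) → Γ ⊩ u ≐ w → Γ ⊩ numA u ys ≐ numA w ys
  numA-cong []       d = d
  numA-cong (y ∷ ys) d = numA-cong ys (⊢-cong d (≐refl (num y)))

  ∘-numA : (u w : Term m) (ys : List 𝕊) → Γ ⊩ u ∘ numA w ys ≐ numA (u ∘ w) ys
  ∘-numA u w []       = ≐refl _
  ∘-numA u w (y ∷ ys) = ≐trans (∘-numA u (w ⊢ num y) ys) (numA-cong ys (∘-⊢ A u w (num y)))

  num-∘ˢ : (a b : 𝕊) → Γ ⊩ num a ∘ num b ≐ num (a ∘ˢ b)
  num-∘ˢ (seq xs) (seq ys) = ≐-cast refl (sym (numA-++ e xs ys))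
    (≐trans (∘-numA (num (seq xs)) e ys) (numA-cong ys (∘-identityʳ A (num (seq xs)))))

  eval : (ρ : Fin n → 𝕊) (t : Term n) → Γ ⊩ subT (nums ρ) t ≐ num (⟦ t ⟧t ρ)
  eval ρ (v i)   = ≐refl _
  eval ρ e       = ≐refl e
  eval ρ (s ⊢ t) = ≐-cast refl (sym (num-⊢ˢ (⟦ s ⟧t ρ) (⟦ t ⟧t ρ))) (⊢-cong (eval ρ s) (eval ρ t))
  eval ρ (s ∘ t) = ≐trans (∘-cong (eval ρ s) (eval ρ t)) (num-∘ˢ (⟦ s ⟧t ρ) (⟦ t ⟧t ρ))

-- Seq refutes false equations between numerals

Discernible : 𝕊 → Set
Discernible a = ∀ b → a ≡ b ⊎ Derivable (¬' (num a ≐ num b))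

All-reverse : ∀ {A : Set} {P : A → Set} {xs : List A} → All P xs → All P (reverse xs)
All-reverse ps = All.tabulate λ x∈ → All.lookup ps (reverse⁻ x∈)

numʳ-≡-or-≢ : ∀ {r₁} → All Discernible r₁ → ∀ r₂ → r₁ ≡ r₂ ⊎ Derivable (¬' (numʳ r₁ ≐ numʳ r₂))
numʳ-≡-or-≢ []       []       = inj₁ refl
numʳ-≡-or-≢ []       (y ∷ r₂) = inj₂ λ A → ⇒I (⇒E (⊢≢e (HasSeqAxioms-∷ _ A) _ _) (≐sym hyp))
numʳ-≡-or-≢ (_ ∷ _)  []       = inj₂ λ A → ⊢≢e A _ _
numʳ-≡-or-≢ (dx ∷ ds) (y ∷ r₂) with dx y
... | inj₂ x≢y = inj₂ λ A → let A′ = HasSeqAxioms-∷ _ A in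
  ⇒I (⇒E (x≢y A′) (∧E₂ (⇒E (⊢-injective A′ _ _ _ _) hyp)))
... | inj₁ refl with numʳ-≡-or-≢ ds r₂
...   | inj₁ refl   = inj₁ refl
...   | inj₂ r₁≢r₂ = inj₂ λ A → let A′ = HasSeqAxioms-∷ _ A in
  ⇒I (⇒E (r₁≢r₂ A′) (∧E₁ (⇒E (⊢-injective A′ _ _ _ _) hyp)))

mutual
  discernible : ∀ a → Discernible a
  discernible (seq xs) (seq ys) with numʳ-≡-or-≢ (All-reverse (discernible-All xs)) (reverse ys)
  ... | inj₁ p  = inj₁ (cong seq (reverse-injective p))
  ... | inj₂ q  = inj₂ λ {_} {Γ} A →
    subst₂ (λ a b → Γ ⊩ ¬' (a ≐ b)) (sym (num-seq xs)) (sym (num-seq ys)) (q A)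

  discernible-All : ∀ xs → All Discernible xs
  discernible-All []       = []
  discernible-All (x ∷ xs) = discernible x ∷ discernible-All xs

-- Seq knows the prefixes of a numeral

∘ˢ-identityʳ : (a : 𝕊) → a ∘ˢ eˢ ≡ a
∘ˢ-identityʳ (seq xs) = cong seq (++-identityʳ xs)

∘ˢ-⊢ˢ : (a b c : 𝕊) → a ∘ˢ (b ⊢ˢ c) ≡ (a ∘ˢ b) ⊢ˢ c
∘ˢ-⊢ˢ (seq xs) (seq ys) c = cong seq (sym (++-assoc xs ys [ c ]))

-- The prefixes of seq (reverse r), longest first.
prefixesʳ : List 𝕊 → List 𝕊
prefixesʳ []      = [ seq [] ]
prefixesʳ (c ∷ r) = seq (reverse (c ∷ r)) ∷ prefixesʳ r

prefixes : 𝕊 → List 𝕊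
prefixes (seq xs) = prefixesʳ (reverse xs)

∈-prefixesʳ : ∀ {p} r → p ∈ prefixesʳ r → Σ 𝕊 λ y → p ∘ˢ y ≡ seq (reverse r)
∈-prefixesʳ []      (here refl) = eˢ , refl
∈-prefixesʳ (c ∷ r) (here refl) = eˢ , ∘ˢ-identityʳ _
∈-prefixesʳ {p} (c ∷ r) (there q) with ∈-prefixesʳ r q
... | y , py≡r = y ⊢ˢ c , (begin
  p ∘ˢ (y ⊢ˢ c)             ≡⟨ ∘ˢ-⊢ˢ p y c ⟩
  (p ∘ˢ y) ⊢ˢ c             ≡⟨ cong (_⊢ˢ c) py≡r ⟩
  seq (reverse r ++ [ c ])  ≡⟨ cong seq (unfold-reverse c r) ⟨
  seq (reverse (c ∷ r))     ∎)
  where open ≡-Reasoning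

∈-prefixes : ∀ {p} a → p ∈ prefixes a → Σ 𝕊 λ y → p ∘ˢ y ≡ a
∈-prefixes (seq xs) q with ∈-prefixesʳ (reverse xs) q
... | y , py≡a = y , trans py≡a (cong seq (reverse-involutive xs))

IsOneOf : Term k → List 𝕊 → Formula k
IsOneOf x []       = ⊥'
IsOneOf x (p ∷ ps) = (x ≐ num p) ∨ IsOneOf x ps

IsOneOf-elim : {Γ : List (Formula m)} {x : Term m} {χ : Formula m} (ps : List 𝕊) →
  (∀ {p} → p ∈ ps → ((x ≐ num p) ∷ Γ) ⊩ χ) → Γ ⊩ IsOneOf x ps → Γ ⊩ χ
IsOneOf-elim []       h d = efq d
IsOneOf-elim (p ∷ ps) h d =
  ∨E d (h (here refl)) (IsOneOf-elim ps (λ q → weaken (∷⁺ʳ _ there) (h (there q))) hyp)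

wkF-IsOneOf : (x : Term n) (ps : List 𝕊) → wkF (IsOneOf x ps) ≡ IsOneOf (wkT x) ps
wkF-IsOneOf x []       = refl
wkF-IsOneOf x (p ∷ ps) = cong₂ (λ a b → (wkT x ≐ a) ∨ b) (wkT-num p) (wkF-IsOneOf x ps)

IsOneOf-prefixesʳ-head : {Γ : List (Formula m)} {x : Term m} (r : List 𝕊) →
  Γ ⊩ x ≐ num (seq (reverse r)) → Γ ⊩ IsOneOf x (prefixesʳ r)
IsOneOf-prefixesʳ-head []      d = ∨I₁ d
IsOneOf-prefixesʳ-head (_ ∷ _) d = ∨I₁ d

-- Assuming x ∘ y = ⌜r⌝, split y by Seq₅: y = e gives the longest prefix, and y = y′ ⊢ z
-- gives x ∘ y′ = ⌜r′⌝ for r = c ∷ r′ by Seq₄ and Seq₂.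
∘-numʳ-prefixes : {Γ : List (Formula m)} → HasSeqAxioms Γ → (r : List 𝕊) (x y : Term m) →
  ((x ∘ y ≐ numʳ r) ∷ Γ) ⊩ IsOneOf x (prefixesʳ r)
∘-numʳ-prefixes {m} {Γ} A r x y = e-or-⊢-elim A′ y case-e
  (subst (Γ₂ ⊩_) (sym (trans (cong wkF (wkF-IsOneOf x _)) (wkF-IsOneOf (wkT x) _)))
    (case-⊢ r x″∘y′⊢z≐r))
  where
  Γ₁ = (x ∘ y ≐ numʳ r) ∷ Γ
  A′ = HasSeqAxioms-∷ _ A
  case-e : ((y ≐ e) ∷ Γ₁) ⊩ IsOneOf x (prefixesʳ r)
  case-e = IsOneOf-prefixesʳ-head r (≐-cast refl (sym (num-seq-reverse r))
    (≐trans (≐sym (∘-identityʳ (HasSeqAxioms-∷ _ A′) x))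
      (≐trans (∘-cong (≐refl x) (≐sym hyp)) (weaken there hyp))))
  x″ y′ z : Term (suc (suc m))
  x″ = wkT (wkT x)
  y′ = v (suc zero)
  z  = v zero
  Γ₂ = (wkT (wkT y) ≐ y′ ⊢ z) ∷ map wkF (map wkF Γ₁)
  A₂ : HasSeqAxioms Γ₂
  A₂ = HasSeqAxioms-∷ _ (HasSeqAxioms-wkF (HasSeqAxioms-wkF A′))
  x″∘y″≐r : Γ₂ ⊩ x″ ∘ wkT (wkT y) ≐ numʳ r
  x″∘y″≐r = ≐-cast refl (trans (cong wkT (wkT-numʳ r)) (wkT-numʳ r)) (ax (there (here refl)))
  x″∘y′⊢z≐r : Γ₂ ⊩ (x″ ∘ y′) ⊢ z ≐ numʳ r
  x″∘y′⊢z≐r = ≐trans (≐sym (∘-⊢ A₂ x″ y′ z)) (≐trans (∘-cong (≐refl x″) (≐sym hyp)) x″∘y″≐r)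
  case-⊢ : ∀ r → Γ₂ ⊩ (x″ ∘ y′) ⊢ z ≐ numʳ r → Γ₂ ⊩ IsOneOf x″ (prefixesʳ r)
  case-⊢ []       d = efq (⇒E (⊢≢e A₂ _ _) d)
  case-⊢ (c ∷ r′) d = ∨I₂ (cut (∧E₁ (⇒E (⊢-injective A₂ _ _ _ _) d)) (∘-numʳ-prefixes A₂ r′ x″ y′))

⊑-num-prefixes : {Γ : List (Formula m)} → HasSeqAxioms Γ → (x : Term m) (a : 𝕊) →
  Γ ⊩ x ⊑ num a → Γ ⊩ IsOneOf x (prefixes a)
⊑-num-prefixes {Γ = Γ} A x (seq xs) d =
  ∃E (subst (λ w → Γ ⊩ ∃' (wkT x ∘ v zero ≐ w)) (trans (wkT-num (seq xs)) (num-seq xs)) d)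
     (subst (((wkT x ∘ v zero ≐ numʳ (reverse xs)) ∷ map wkF Γ) ⊩_) (sym (wkF-IsOneOf x _))
       (∘-numʳ-prefixes (HasSeqAxioms-wkF A) (reverse xs) (wkT x) (v zero)))

⟦⊑⟧-intro : (ρ : Fin n → 𝕊) (s t : Term n) → Σ 𝕊 (λ y → ⟦ s ⟧t ρ ∘ˢ y ≡ ⟦ t ⟧t ρ) → ⟦ s ⊑ t ⟧ ρ
⟦⊑⟧-intro ρ s t (y , sy≡t) = y , trans (cong (_∘ˢ y) (⟦wkT⟧ s ρ y)) (trans sy≡t (sym (⟦wkT⟧ t ρ y)))

module _ (ρ : Fin n → 𝕊) where

  ≐-complete : (s t : Term n) → ⟦ s ≐ t ⟧ ρ → Derivable (subF (nums ρ) (s ≐ t))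
  ≐-complete s t s≡t A = ≐trans (eval A ρ s) (≐-cast (cong num (sym s≡t)) refl (≐sym (eval A ρ t)))

  ≢-complete : (s t : Term n) → ⟦ ¬' (s ≐ t) ⟧ ρ → Derivable (subF (nums ρ) (¬' (s ≐ t)))
  ≢-complete s t s≢t A with discernible (⟦ s ⟧t ρ) (⟦ t ⟧t ρ)
  ... | inj₁ s≡t = ⊥-elim (s≢t s≡t)
  ... | inj₂ q   = ⇒I (⇒E (q A′) (≐trans (≐sym (eval A′ ρ s)) (≐trans hyp (eval A′ ρ t))))
    where A′ = HasSeqAxioms-∷ _ A

  ∃-complete : (φ : Formula (suc n)) (a : 𝕊) →
    Derivable (subF (nums (extend ρ a)) φ) → Derivable (subF (nums ρ) (∃' φ))
  ∃-complete φ a d {Γ = Γ} A = ∃I (num a) (subst (Γ ⊩_) (sym (subF-inst-num ρ a φ)) (d A))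

  ⋢-complete : (s t : Term n) → ⟦ ¬' (s ⊑ t) ⟧ ρ → Derivable (subF (nums ρ) (¬' (s ⊑ t)))
  ⋢-complete s t s⋢t {Γ = Γ} A = ⇒I (subst (λ ψ → (ψ ∷ Γ) ⊩ ⊥') (sym (subF-⊑ (nums ρ) s t))
    (IsOneOf-elim _ refute (⊑-num-prefixes A′ s′ (⟦ t ⟧t ρ) (⊑-resp-≐ (eval A′ ρ t) hyp))))
    where
    s′ = subT (nums ρ) s
    Δ = (s′ ⊑ subT (nums ρ) t) ∷ Γ
    A′ = HasSeqAxioms-∷ _ A
    refute : ∀ {p} → p ∈ prefixes (⟦ t ⟧t ρ) → ((s′ ≐ num p) ∷ Δ) ⊩ ⊥'
    refute {p} q with discernible (⟦ s ⟧t ρ) p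
    ... | inj₁ refl = ⊥-elim (s⋢t (⟦⊑⟧-intro ρ s t (∈-prefixes _ q)))
    ... | inj₂ s≢p  = ⇒E (s≢p A″) (≐trans (≐sym (eval A″ ρ s)) hyp)
      where A″ = HasSeqAxioms-∷ _ A′

  ∀⊑-complete : (t : Term n) (φ : Formula (suc n)) →
    (∀ a → ⟦ φ ⟧ (extend ρ a) → Derivable (subF (nums (extend ρ a)) φ)) →
    ⟦ ∀⊑ t φ ⟧ ρ → Derivable (subF (nums ρ) (∀⊑ t φ))
  ∀⊑-complete t φ ih sat {Γ = Γ} A = ∀I (⇒I (subst (λ ψ → (ψ ∷ Δ) ⊩ χ) (sym bound-form)
    (IsOneOf-elim _ at-prefix (⊑-num-prefixes A′ (v zero) (⟦ t ⟧t ρ) (⊑-resp-≐ (eval A′ ρ t) hyp)))))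
    where
    Δ = map wkF Γ
    χ = subF (liftS (nums ρ)) φ
    bound-form : subF (liftS (nums ρ)) (v zero ⊑ wkT t) ≡ (v zero ⊑ subT (nums ρ) t)
    bound-form = trans (subF-⊑ _ (v zero) (wkT t)) (cong (v zero ⊑_) (subT-liftS-nums-wkT ρ t))
    Δ′ = (v zero ⊑ subT (nums ρ) t) ∷ Δ
    A′ = HasSeqAxioms-∷ _ (HasSeqAxioms-wkF A)
    at-prefix : ∀ {p} → p ∈ prefixes (⟦ t ⟧t ρ) → ((v zero ≐ num p) ∷ Δ′) ⊩ χ
    at-prefix {p} q = subst (Δ″ ⊩_) (subF-inst-v₀ ρ φ)
      (≐subst (subF (liftS (nums ρ)) φ) (≐sym hyp)
        (subst (Δ″ ⊩_) (sym (subF-inst-num ρ p φ)) (ih p (sat p p⊑t) (HasSeqAxioms-∷ _ A′))))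
      where
      Δ″ = (v zero ≐ num p) ∷ Δ′
      p⊑t : ⟦ v zero ⊑ wkT t ⟧ (extend ρ p)
      p⊑t with ∈-prefixes _ q
      ... | y , py≡t = ⟦⊑⟧-intro (extend ρ p) (v zero) (wkT t) (y , trans py≡t (sym (⟦wkT⟧ t ρ p)))

Σ-complete : {φ : Formula n} → IsΣ φ → (ρ : Fin n → 𝕊) → ⟦ φ ⟧ ρ → Derivable (subF (nums ρ) φ)
Σ-complete (atom s t)    ρ sat = ≐-complete ρ s t sat
Σ-complete (negatom s t) ρ sat = ≢-complete ρ s t sat
Σ-complete (sub s t)     ρ (a , sat) =
  ∃-complete ρ (wkT s ∘ v zero ≐ wkT t) a (≐-complete (extend ρ a) (wkT s ∘ v zero) (wkT t) sat)
Σ-complete (negsub s t)  ρ sat = ⋢-complete ρ s t sat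
Σ-complete (and h₁ h₂)   ρ (sat₁ , sat₂) A = ∧I (Σ-complete h₁ ρ sat₁ A) (Σ-complete h₂ ρ sat₂ A)
Σ-complete (or h₁ h₂)    ρ (inj₁ sat) A = ∨I₁ (Σ-complete h₁ ρ sat A)
Σ-complete (or h₁ h₂)    ρ (inj₂ sat) A = ∨I₂ (Σ-complete h₂ ρ sat A)
Σ-complete (ex h)        ρ (a , sat) = ∃-complete ρ _ a (Σ-complete h (extend ρ a) sat)
Σ-complete (ball t h)    ρ sat = ∀⊑-complete ρ t _ (λ a → Σ-complete h (extend ρ a)) sat

corollary1 : (φ : Formula 0) → IsΣ φ → φ ⊨𝔖 → SeqProves φ
corollary1 φ h sat = subst (SeqAxioms ⊩_) (trans (subF-ext (λ ()) φ) (subF-v φ))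
  (Σ-complete h noVars sat SeqAxioms-HasSeqAxioms)
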